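{- Let $(s,\gamma,w)$ be a weighted labelled chain. Then $$K_{(s,\gamma,w)}=\sum_{\alpha(s,w)\preccurlyeq\beta\preccurlyeq\delta(s,\gamma,w)}M_\beta .$$
   Context: Let $\mathbb N=\{1,2,\dots\}$. A labelling of a finite poset $P$ is an injective map $\gamma$ from $P$ to a chain; a weight function is $w:P\to\mathbb N$. A $(P,\gamma)$-partition is $f:P\to\mathbb N$ with, for all $p<q$, $f(p)\le f(q)$ and $f(p)=f(q)\Rightarrow\gamma(p)<\gamma(q)$. $K_{(P,\gamma,w)}=\sum_f\prod_{u\in P}x_{f(u)}^{w(u)}$ over all $(P,\gamma)$-partitions. A weighted labelled chain is such a triple with $P=s$ a finite chain $u_1<\dots<u_\ell$; let $w(s)=\sum_jw(u_j)$. For a composition $\alpha\vDash n$ (sequence of positive integers summing to $n$), $\mathrm{set}(\alpha)=\{\alpha_1,\alpha_1+\alpha_2,\dots,\alpha_1+\dots+\alpha_{\ell(\alpha)-1}\}\subseteq[n-1]$, and $\mathrm{comp}(S)$ is the inverse bijection. For compositions of the same size, $\alpha\preccurlyeq\beta$ means $\mathrm{set}(\beta)\subseteq\mathrm{set}(\alpha)$. Define $\alpha(s,w)=(w(u_1),\dots,w(u_\ell))$ and $\delta(s,\gamma,w)=\mathrm{comp}(\{\sum_{j=1}^kw(u_j):1\le k<\ell,\ \gamma(u_k)>\gamma(u_{k+1})\})$, both compositions of $w(s)$. $M_\beta=\sum_{i_1<\dots<i_{\ell(\beta)}}x_{i_1}^{\beta_1}\cdots x_{i_{\ell(\beta)}}^{\beta_{\ell(\beta)}}$.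 -}

module Defs where

open import Data.Nat using (ℕ; zero; suc; _+_; _∸_; _≡ᵇ_; _<ᵇ_)
open import Data.Fin using (Fin; toℕ) renaming (zero to fzero; suc to fsuc)
open import Data.List using (List; []; _∷_; [_]; map; filter; length; concatMap; foldr; tabulate; allFin; zip)
open import Data.Nat.ListAction using (sum)
open import Data.Bool.ListAction using (all; any)
open import Data.Bool using (Bool; true; false; _∧_; _∨_; not; if_then_else_)
open import Data.Product using (_×_; _,_)

-- Formal power series in x₁, x₂, … with ℕ coefficients, given by their
-- coefficient function.  A list e = (e₁,…,e_N) stands for the monomial
-- x₁^e₁ ⋯ x_N^e_N (trailing zeros denote the same monomial; every series
-- below assigns such lists the same coefficient).

Series : Set
Series = List ℕ → ℕ

sumSeries : List Series → Series
sumSeries Fs e = sum (map (λ F → F e) Fs)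

eqList : List ℕ → List ℕ → Bool
eqList []       []       = true
eqList (a ∷ as) (b ∷ bs) = (a ≡ᵇ b) ∧ eqList as bs
eqList _        _        = false

allPairs : (k : ℕ) → List (Fin k × Fin k)
allPairs k = concatMap (λ i → map (λ j → i , j)
                         (filter′ (λ j → toℕ i <ᵇ toℕ j) (allFin k))) (allFin k)
  where
  filter′ : {n : ℕ} → (Fin n → Bool) → List (Fin n) → List (Fin n)
  filter′ p []       = []
  filter′ p (x ∷ xs) = if p x then x ∷ filter′ p xs else filter′ p xs

countB : {A : Set} → (A → Bool) → List A → ℕ
countB p []       = 0
countB p (x ∷ xs) = (if p x then 1 else 0) + countB p xs

extend : {k N : ℕ} → Fin N → (Fin k → Fin N) → Fin (suc k) → Fin N
extend a g fzero    = a
extend a g (fsuc i) = g i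

allFuns : (k N : ℕ) → List (Fin k → Fin N)
allFuns zero    N = [ (λ ()) ]
allFuns (suc k) N = concatMap (λ a → map (extend a) (allFuns k N)) (allFin N)

-- exponent vector (e₁,…,e_N) of ∏_{u} x_{g(u)+1}^{c(u)}
expOf : {k N : ℕ} → (Fin k → ℕ) → (Fin k → Fin N) → List ℕ
expOf {k} {N} c g =
  map (λ j → sum (map (λ u → if toℕ (g u) ≡ᵇ toℕ j then c u else 0) (allFin k)))
      (allFin N)

-- Weighted labelled chain: the chain u₁ < … < u_ℓ is Fin ℓ with its
-- natural order; γ : Fin ℓ → ℕ the labelling, w : Fin ℓ → ℕ the weights.

-- (s,γ)-partition condition for f (values shifted by one: index j means j+1)
isPartition : {ℓ N : ℕ} → (Fin ℓ → ℕ) → (Fin ℓ → Fin N) → Bool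
isPartition {ℓ} γ f =
  all (λ { (p , q) → (toℕ (f p) <ᵇ toℕ (f q))
                     ∨ ((toℕ (f p) ≡ᵇ toℕ (f q)) ∧ (γ p <ᵇ γ q)) })
      (allPairs ℓ)

-- K_(s,γ,w) as a series: coefficient of x^e = number of (s,γ)-partitions
-- f with ∏ x_{f(u)}^{w(u)} = x^e (such f take values in {1,…,length e}).
K : {ℓ : ℕ} → (Fin ℓ → ℕ) → (Fin ℓ → ℕ) → Series
K {ℓ} γ w e =
  countB (λ f → isPartition γ f ∧ eqList (expOf w f) e) (allFuns ℓ (length e))

-- Monomial quasisymmetric function M_β: coefficient of x^e = number of
-- i₁ < … < i_k (k = ℓ(β)) with x_{i₁}^{β₁}⋯x_{i_k}^{β_k} = x^e.
lookupL : List ℕ → ℕ → ℕ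
lookupL []       _       = 0
lookupL (a ∷ as) zero    = a
lookupL (a ∷ as) (suc n) = lookupL as n

strictlyIncr : {k N : ℕ} → (Fin k → Fin N) → Bool
strictlyIncr {k} g = all (λ { (a , b) → toℕ (g a) <ᵇ toℕ (g b) }) (allPairs k)

M : List ℕ → Series
M β e = countB (λ g → strictlyIncr g ∧ eqList (expOf (λ t → lookupL β (toℕ t)) g) e)
               (allFuns (length β) (length e))

-- all compositions of n (each composition of n+1 arises uniquely from one
-- of n by prepending a part 1 or incrementing the first part)
incFirst : List ℕ → List (List ℕ)
incFirst []      = []
incFirst (a ∷ c) = [ suc a ∷ c ]

compositions : ℕ → List (List ℕ)
compositions zero    = [ [] ]
compositions (suc n) = concatMap (λ c → (1 ∷ c) ∷ incFirst c) (compositions n)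

-- set(α) = {α₁, α₁+α₂, …, α₁+⋯+α_{ℓ-1}}
setAux : ℕ → List ℕ → List ℕ
setAux acc []           = []
setAux acc (a ∷ [])     = []
setAux acc (a ∷ b ∷ as) = (acc + a) ∷ setAux (acc + a) (b ∷ as)

setC : List ℕ → List ℕ
setC = setAux 0

-- comp(S) for S ⊆ [n-1] listed increasingly
diffs : ℕ → List ℕ → ℕ → List ℕ
diffs prev []      n = [ n ∸ prev ]
diffs prev (s ∷ S) n = (s ∸ prev) ∷ diffs s S n

comp : ℕ → List ℕ → List ℕ
comp zero    S = []
comp (suc n) S = diffs 0 S (suc n)

memB : ℕ → List ℕ → Bool
memB x xs = any (λ y → x ≡ᵇ y) xs

_≼_ : List ℕ → List ℕ → Bool
α ≼ β = all (λ x → memB x (setC α)) (setC β)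

alphaC : {ℓ : ℕ} → (Fin ℓ → ℕ) → List ℕ
alphaC w = tabulate w

weight : {ℓ : ℕ} → (Fin ℓ → ℕ) → ℕ
weight w = sum (tabulate w)

-- descent set {w(u₁)+⋯+w(u_k) : 1 ≤ k < ℓ, γ(u_k) > γ(u_{k+1})}, increasing
descAux : ℕ → ℕ × ℕ → List (ℕ × ℕ) → List ℕ
descAux acc (w₁ , g₁) []              = []
descAux acc (w₁ , g₁) ((w₂ , g₂) ∷ r) =
  if g₂ <ᵇ g₁ then (acc + w₁) ∷ descAux (acc + w₁) (w₂ , g₂) r
              else descAux (acc + w₁) (w₂ , g₂) r

descents : List (ℕ × ℕ) → List ℕ
descents []      = []
descents (x ∷ r) = descAux 0 x r

deltaC : {ℓ : ℕ} → (Fin ℓ → ℕ) → (Fin ℓ → ℕ) → List ℕ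
deltaC γ w = comp (weight w) (descents (zip (tabulate w) (tabulate γ)))

interval : {ℓ : ℕ} → (Fin ℓ → ℕ) → (Fin ℓ → ℕ) → List (List ℕ)
interval γ w = filter′ (λ β → (alphaC w ≼ β) ∧ (β ≼ deltaC γ w))
                       (compositions (weight w))
  where
  filter′ : (List ℕ → Bool) → List (List ℕ) → List (List ℕ)
  filter′ p []       = []
  filter′ p (x ∷ xs) = if p x then x ∷ filter′ p xs else filter′ p xs

-- Split K and every M_β according to the bottom value a = f(u₁) of the filling f. With a
-- fixed, the next value b either exceeds a or equals a, and a (s,γ)-partition may repeat a
-- value exactly across an ascent γ(u₁) < γ(u₂). On the M side the first case starts β with
-- the part w(u₁) and the second merges w(u₁) into the first part of β. The interval
-- α(s,w) ≼ β ≼ δ(s,γ,w) respects both operations (merging is admissible precisely when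
-- w(u₁) is not a descent position), so induction along the chain matches the two sums.

module Submission where

open import Defs
open import Data.Nat using (ℕ; zero; suc; _+_; _*_; _∸_; _≡ᵇ_; _<ᵇ_; _≤ᵇ_; _≤_; _<_; z≤n; s≤s)
open import Data.Nat.Properties
open import Data.Nat.ListAction using (sum)
open import Data.Nat.Solver using (module +-*-Solver)
open import Data.Fin using (Fin; toℕ) renaming (zero to fzero; suc to fsuc)
open import Data.Fin.Properties using () renaming (suc-injective to fsuc-injective)
open import Data.List
  using (List; []; _∷_; map; length; concatMap; foldr; tabulate; allFin; zip; zipWith; _++_; replicate)
open import Data.List.Properties using (map-tabulate; map-cong; map-∘; length-map)
open import Data.List.Membership.Propositional using (_∈_)
open import Data.List.Membership.Propositional.Properties using (∈-allFin)
open import Data.List.Relation.Unary.Any using (here; there)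
open import Data.List.Relation.Unary.All as All using (All; []; _∷_)
open import Data.Bool using (Bool; true; false; _∧_; _∨_; if_then_else_; T)
open import Data.Bool.Properties
  using (∧-commutativeMonoid; ∧-assoc; ∧-zeroʳ; ∧-conicalˡ; ∧-conicalʳ; ∨-identityʳ; ∨-zeroʳ)
open import Data.Bool.ListAction using (all)
open import Data.Product using (_×_; _,_)
open import Data.Sum using (_⊎_; inj₁; inj₂)
open import Data.Unit using (⊤; tt)
open import Data.Empty using (⊥; ⊥-elim)
open import Relation.Binary.PropositionalEquality
open import Function using (_∘_)
open import Function.Definitions using (Injective)
open import Algebra.Bundles using (CommutativeMonoid)
open import Algebra.Properties.CommutativeSemigroup +-commutativeSemigroup
  using () renaming (interchange to +-interchange)
open import Algebra.Properties.CommutativeSemigroup *-commutativeSemigroup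
  using () renaming (x∙yz≈y∙xz to *-exchangeˡ)
open import Algebra.Properties.CommutativeSemigroup
  (CommutativeMonoid.commutativeSemigroup ∧-commutativeMonoid)
  using () renaming (interchange to ∧-interchange)

⟦_⟧ : Bool → ℕ
⟦ b ⟧ = if b then 1 else 0

⟦∧⟧ : ∀ b c → ⟦ b ∧ c ⟧ ≡ ⟦ b ⟧ * ⟦ c ⟧
⟦∧⟧ true  c = sym (+-identityʳ ⟦ c ⟧)
⟦∧⟧ false c = refl

T⇒≡true : ∀ {b} → T b → b ≡ true
T⇒≡true {true} _ = refl

≡true⇒T : ∀ {b} → b ≡ true → T b
≡true⇒T refl = tt

bool-ext : ∀ {b c} → (b ≡ true → c ≡ true) → (c ≡ true → b ≡ true) → b ≡ c
bool-ext {false} {false} f g = refl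
bool-ext {false} {true}  f g = g refl
bool-ext {true}  {false} f g = sym (f refl)
bool-ext {true}  {true}  f g = refl

∧-true₁ : ∀ {b c} → b ∧ c ≡ true → b ≡ true
∧-true₁ {b} {c} = ∧-conicalˡ b c

∧-true₂ : ∀ {b c} → b ∧ c ≡ true → c ≡ true
∧-true₂ {b} {c} = ∧-conicalʳ b c

≡ᵇ-sound : ∀ {m n} → (m ≡ᵇ n) ≡ true → m ≡ n
≡ᵇ-sound {m} {n} e = ≡ᵇ⇒≡ m n (≡true⇒T e)

≡ᵇ-complete : ∀ {m n} → m ≡ n → (m ≡ᵇ n) ≡ true
≡ᵇ-complete {m} {n} e = T⇒≡true (≡⇒≡ᵇ m n e)

<ᵇ-sound : ∀ {m n} → (m <ᵇ n) ≡ true → m < n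
<ᵇ-sound {m} {n} e = <ᵇ⇒< m n (≡true⇒T e)

<ᵇ-complete : ∀ {m n} → m < n → (m <ᵇ n) ≡ true
<ᵇ-complete m<n = T⇒≡true (<⇒<ᵇ m<n)

≤ᵇ-sound : ∀ {m n} → (m ≤ᵇ n) ≡ true → m ≤ n
≤ᵇ-sound {m} {n} e = ≤ᵇ⇒≤ m n (≡true⇒T e)

≤ᵇ-complete : ∀ {m n} → m ≤ n → (m ≤ᵇ n) ≡ true
≤ᵇ-complete m≤n = T⇒≡true (≤⇒≤ᵇ m≤n)

≢⇒≡ᵇ-false : ∀ {m n} → (m ≡ n → ⊥) → (m ≡ᵇ n) ≡ false
≢⇒≡ᵇ-false {m} {n} m≢n with m ≡ᵇ n in eq
... | true  = ⊥-elim (m≢n (≡ᵇ-sound eq))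
... | false = refl

≮⇒<ᵇ-false : ∀ {m n} → (m < n → ⊥) → (m <ᵇ n) ≡ false
≮⇒<ᵇ-false {m} {n} m≮n with m <ᵇ n in eq
... | true  = ⊥-elim (m≮n (<ᵇ-sound eq))
... | false = refl

<ᵇ-false⇒≮ : ∀ {m n} → (m <ᵇ n) ≡ false → m < n → ⊥
<ᵇ-false⇒≮ m≮n m<n with () ← trans (sym m≮n) (<ᵇ-complete m<n)

<ᵇ-trans : ∀ x y z → (x <ᵇ y) ≡ true → (y <ᵇ z) ≡ true → (x <ᵇ z) ≡ true
<ᵇ-trans x y z x<y y<z = <ᵇ-complete (<-trans (<ᵇ-sound {x} {y} x<y) (<ᵇ-sound {y} {z} y<z))

sumOver : {A : Set} → List A → (A → ℕ) → ℕ
sumOver L f = sum (map f L)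

sumOver-cong : {A : Set} (L : List A) {f g : A → ℕ} → (∀ x → f x ≡ g x) → sumOver L f ≡ sumOver L g
sumOver-cong []      f≗g = refl
sumOver-cong (x ∷ L) f≗g = cong₂ _+_ (f≗g x) (sumOver-cong L f≗g)

sumOver-+ : {A : Set} (L : List A) (f g : A → ℕ) →
            sumOver L (λ x → f x + g x) ≡ sumOver L f + sumOver L g
sumOver-+ []      f g = refl
sumOver-+ (x ∷ L) f g rewrite sumOver-+ L f g = +-interchange (f x) (g x) (sumOver L f) (sumOver L g)

sumOver-*ˡ : {A : Set} (L : List A) (c : ℕ) (f : A → ℕ) → sumOver L (λ x → c * f x) ≡ c * sumOver L f
sumOver-*ˡ []      c f = sym (*-zeroʳ c)
sumOver-*ˡ (x ∷ L) c f rewrite sumOver-*ˡ L c f = sym (*-distribˡ-+ c (f x) (sumOver L f))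

sumOver-zero : {A : Set} (L : List A) → sumOver L (λ _ → 0) ≡ 0
sumOver-zero []      = refl
sumOver-zero (x ∷ L) = sumOver-zero L

sumOver-comm : {A B : Set} (L : List A) (M : List B) (f : A → B → ℕ) →
               sumOver L (λ a → sumOver M (f a)) ≡ sumOver M (λ b → sumOver L (λ a → f a b))
sumOver-comm []      M f = sym (sumOver-zero M)
sumOver-comm (x ∷ L) M f rewrite sumOver-comm L M f = sym (sumOver-+ M (f x) (λ b → sumOver L (λ a → f a b)))

sumOver-++ : {A : Set} (L M : List A) (f : A → ℕ) → sumOver (L ++ M) f ≡ sumOver L f + sumOver M f
sumOver-++ []      M f = refl
sumOver-++ (x ∷ L) M f rewrite sumOver-++ L M f = sym (+-assoc (f x) (sumOver L f) (sumOver M f))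

sumOver-concatMap : {A B : Set} (L : List A) (h : A → List B) (f : B → ℕ) →
                    sumOver (concatMap h L) f ≡ sumOver L (λ a → sumOver (h a) f)
sumOver-concatMap []      h f = refl
sumOver-concatMap (x ∷ L) h f
  rewrite sumOver-++ (h x) (concatMap h L) f | sumOver-concatMap L h f = refl

sumOver-map : {A B : Set} (L : List A) (h : A → B) (f : B → ℕ) → sumOver (map h L) f ≡ sumOver L (f ∘ h)
sumOver-map []      h f = refl
sumOver-map (x ∷ L) h f = cong (f (h x) +_) (sumOver-map L h f)

sumFin : (N : ℕ) → (Fin N → ℕ) → ℕ
sumFin N = sumOver (allFin N)

sumFin-suc : (N : ℕ) (h : Fin (suc N) → ℕ) → sumFin (suc N) h ≡ h fzero + sumFin N (h ∘ fsuc)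
sumFin-suc N h = cong (λ L → h fzero + sum L)
  (trans (map-tabulate fsuc h) (sym (map-tabulate (λ i → i) (h ∘ fsuc))))

sumFin-δ : (N : ℕ) (a : Fin N) (X : Fin N → ℕ) → sumFin N (λ b → ⟦ toℕ a ≡ᵇ toℕ b ⟧ * X b) ≡ X a
sumFin-δ (suc N) fzero X = begin
    sumFin (suc N) (λ b → ⟦ 0 ≡ᵇ toℕ b ⟧ * X b) ≡⟨ sumFin-suc N _ ⟩
    X fzero + 0 + sumFin N (λ _ → 0)            ≡⟨ cong₂ _+_ (+-identityʳ (X fzero)) (sumOver-zero (allFin N)) ⟩
    X fzero + 0                                  ≡⟨ +-identityʳ (X fzero) ⟩
    X fzero                                      ∎
  where open ≡-Reasoning
sumFin-δ (suc N) (fsuc a) X =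
  trans (sumFin-suc N (λ b → ⟦ toℕ (fsuc a) ≡ᵇ toℕ b ⟧ * X b)) (sumFin-δ N a (X ∘ fsuc))

countB-cong : {A : Set} (L : List A) {p q : A → Bool} → (∀ x → p x ≡ q x) → countB p L ≡ countB q L
countB-cong []      p≗q = refl
countB-cong (x ∷ L) p≗q = cong₂ _+_ (cong ⟦_⟧ (p≗q x)) (countB-cong L p≗q)

countB-sumOver : {A : Set} (L : List A) (p : A → Bool) → countB p L ≡ sumOver L (λ x → ⟦ p x ⟧)
countB-sumOver []      p = refl
countB-sumOver (x ∷ L) p = cong (⟦ p x ⟧ +_) (countB-sumOver L p)

countB-const∧ : {A : Set} (L : List A) (b : Bool) (q : A → Bool) →
                countB (λ x → b ∧ q x) L ≡ ⟦ b ⟧ * countB q L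
countB-const∧ L       true  q = sym (+-identityʳ _)
countB-const∧ []      false q = refl
countB-const∧ (x ∷ L) false q = countB-const∧ L false q

countB-allFuns-suc : (k N : ℕ) (p : (Fin (suc k) → Fin N) → Bool) →
  countB p (allFuns (suc k) N) ≡ sumFin N (λ a → countB (p ∘ extend a) (allFuns k N))
countB-allFuns-suc k N p = begin
    countB p (allFuns (suc k) N)
      ≡⟨ countB-sumOver (allFuns (suc k) N) p ⟩
    sumOver (concatMap (λ a → map (extend a) (allFuns k N)) (allFin N)) (λ f → ⟦ p f ⟧)
      ≡⟨ sumOver-concatMap (allFin N) _ _ ⟩
    sumFin N (λ a → sumOver (map (extend a) (allFuns k N)) (λ f → ⟦ p f ⟧))
      ≡⟨ sumOver-cong (allFin N) (λ a → trans (sumOver-map (allFuns k N) (extend a) _)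
                                             (sym (countB-sumOver (allFuns k N) (p ∘ extend a)))) ⟩
    sumFin N (λ a → countB (p ∘ extend a) (allFuns k N)) ∎
  where open ≡-Reasoning

infix  7 _≤ᵛ_
infixl 8 _+ᵛ_ _∸ᵛ_

_≤ᵛ_ : List ℕ → List ℕ → Bool
[]    ≤ᵛ e       = true
(x ∷ d) ≤ᵛ []      = false
(x ∷ d) ≤ᵛ (z ∷ e) = (x ≤ᵇ z) ∧ (d ≤ᵛ e)

_∸ᵛ_ : List ℕ → List ℕ → List ℕ
e       ∸ᵛ []      = e
[]      ∸ᵛ (x ∷ d) = []
(z ∷ e) ∸ᵛ (x ∷ d) = (z ∸ x) ∷ (e ∸ᵛ d)

_+ᵛ_ : List ℕ → List ℕ → List ℕ
_+ᵛ_ = zipWith _+_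

single : {N : ℕ} → Fin N → ℕ → List ℕ
single {N} a x = map (λ j → if toℕ a ≡ᵇ toℕ j then x else 0) (allFin N)

zeros : ℕ → List ℕ
zeros N = map (λ _ → 0) (allFin N)

+≡ᵇ-split : ∀ x y z → (x + y ≡ᵇ z) ≡ (x ≤ᵇ z) ∧ (y ≡ᵇ z ∸ x)
+≡ᵇ-split x y z = bool-ext to from
  where
  to : (x + y ≡ᵇ z) ≡ true → (x ≤ᵇ z) ∧ (y ≡ᵇ z ∸ x) ≡ true
  to e with ≡ᵇ-sound {x + y} {z} e
  ... | refl rewrite ≤ᵇ-complete (m≤m+n x y) = ≡ᵇ-complete {y} {x + y ∸ x} (sym (m+n∸m≡n x y))
  from : (x ≤ᵇ z) ∧ (y ≡ᵇ z ∸ x) ≡ true → (x + y ≡ᵇ z) ≡ true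
  from e with ≤ᵇ-sound {x} {z} (∧-true₁ e) | ≡ᵇ-sound {y} {z ∸ x} (∧-true₂ {x ≤ᵇ z} e)
  ... | x≤z | refl = ≡ᵇ-complete {x + (z ∸ x)} {z} (m+[n∸m]≡n x≤z)

+≤ᵇ-split : ∀ x y z → (x + y ≤ᵇ z) ≡ (x ≤ᵇ z) ∧ (y ≤ᵇ z ∸ x)
+≤ᵇ-split x y z = bool-ext to from
  where
  to : (x + y ≤ᵇ z) ≡ true → (x ≤ᵇ z) ∧ (y ≤ᵇ z ∸ x) ≡ true
  to e with ≤ᵇ-sound {x + y} {z} e
  ... | x+y≤z rewrite ≤ᵇ-complete (≤-trans (m≤m+n x y) x+y≤z) =
    ≤ᵇ-complete (subst (_≤ z ∸ x) (m+n∸m≡n x y) (∸-monoˡ-≤ x x+y≤z))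
  from : (x ≤ᵇ z) ∧ (y ≤ᵇ z ∸ x) ≡ true → (x + y ≤ᵇ z) ≡ true
  from e with ≤ᵇ-sound {x} {z} (∧-true₁ e) | ≤ᵇ-sound {y} {z ∸ x} (∧-true₂ {x ≤ᵇ z} e)
  ... | x≤z | y≤z∸x = ≤ᵇ-complete (subst (x + y ≤_) (m+[n∸m]≡n x≤z) (+-monoʳ-≤ x y≤z∸x))

eqList-+ᵛ : (d v e : List ℕ) → length d ≡ length v →
            eqList (d +ᵛ v) e ≡ (d ≤ᵛ e) ∧ eqList v (e ∸ᵛ d)
eqList-+ᵛ []      []      e       eq = refl
eqList-+ᵛ (x ∷ d) (y ∷ v) []      eq = refl
eqList-+ᵛ (x ∷ d) (y ∷ v) (z ∷ e) eq
  rewrite eqList-+ᵛ d v e (suc-injective eq) | +≡ᵇ-split x y z =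
  ∧-interchange (x ≤ᵇ z) (y ≡ᵇ z ∸ x) (d ≤ᵛ e) (eqList v (e ∸ᵛ d))

+ᵛ-≤ᵛ : (d₁ d₂ e : List ℕ) → length d₁ ≡ length d₂ →
        (d₁ +ᵛ d₂) ≤ᵛ e ≡ (d₁ ≤ᵛ e) ∧ (d₂ ≤ᵛ (e ∸ᵛ d₁))
+ᵛ-≤ᵛ []      []      e       eq = refl
+ᵛ-≤ᵛ (x ∷ d₁) (y ∷ d₂) []      eq = refl
+ᵛ-≤ᵛ (x ∷ d₁) (y ∷ d₂) (z ∷ e) eq
  rewrite +ᵛ-≤ᵛ d₁ d₂ e (suc-injective eq) | +≤ᵇ-split x y z =
  ∧-interchange (x ≤ᵇ z) (y ≤ᵇ z ∸ x) (d₁ ≤ᵛ e) (d₂ ≤ᵛ (e ∸ᵛ d₁))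

∸ᵛ-+ᵛ : (d₁ d₂ e : List ℕ) → length d₁ ≡ length d₂ → e ∸ᵛ (d₁ +ᵛ d₂) ≡ (e ∸ᵛ d₁) ∸ᵛ d₂
∸ᵛ-+ᵛ []       []       e       eq = refl
∸ᵛ-+ᵛ (x ∷ d₁) (y ∷ d₂) []      eq = refl
∸ᵛ-+ᵛ (x ∷ d₁) (y ∷ d₂) (z ∷ e) eq =
  cong₂ _∷_ (sym (∸-+-assoc z x y)) (∸ᵛ-+ᵛ d₁ d₂ e (suc-injective eq))

zipWith-map-map : {A B C X : Set} (f : A → B → C) (g : X → A) (h : X → B) (L : List X) →
                  zipWith f (map g L) (map h L) ≡ map (λ x → f (g x) (h x)) L
zipWith-map-map f g h []      = refl
zipWith-map-map f g h (x ∷ L) = cong (f (g x) (h x) ∷_) (zipWith-map-map f g h L)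

length-map-map : {A B C : Set} (f : A → B) (g : A → C) (L : List A) → length (map f L) ≡ length (map g L)
length-map-map f g L = trans (length-map f L) (sym (length-map g L))

single-+ : {N : ℕ} (a : Fin N) (x y : ℕ) → single a (x + y) ≡ single a x +ᵛ single a y
single-+ {N} a x y = sym (trans (zipWith-map-map _+_ _ _ (allFin N)) (map-cong pointwise (allFin N)))
  where
  pointwise : ∀ j → (if toℕ a ≡ᵇ toℕ j then x else 0) + (if toℕ a ≡ᵇ toℕ j then y else 0)
                  ≡ (if toℕ a ≡ᵇ toℕ j then x + y else 0)
  pointwise j with toℕ a ≡ᵇ toℕ j
  ... | true  = refl
  ... | false = refl

single-+ᵛ-≤ᵛ : {N : ℕ} (a : Fin N) (x y : ℕ) (e : List ℕ) →
               single a (x + y) ≤ᵛ e ≡ (single a x ≤ᵛ e) ∧ (single a y ≤ᵛ (e ∸ᵛ single a x))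
single-+ᵛ-≤ᵛ {N} a x y e rewrite single-+ a x y =
  +ᵛ-≤ᵛ (single a x) (single a y) e (length-map-map _ _ (allFin N))

∸ᵛ-single-+ : {N : ℕ} (a : Fin N) (x y : ℕ) (e : List ℕ) →
              e ∸ᵛ single a (x + y) ≡ (e ∸ᵛ single a x) ∸ᵛ single a y
∸ᵛ-single-+ {N} a x y e rewrite single-+ a x y =
  ∸ᵛ-+ᵛ (single a x) (single a y) e (length-map-map _ _ (allFin N))

expOf-extend : {k N : ℕ} (c : Fin (suc k) → ℕ) (a : Fin N) (g : Fin k → Fin N) →
               expOf c (extend a g) ≡ single a (c fzero) +ᵛ expOf (c ∘ fsuc) g
expOf-extend {k} {N} c a g = sym (trans (zipWith-map-map _+_ _ _ (allFin N)) (map-cong pointwise (allFin N)))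
  where
  pointwise : ∀ j → (if toℕ a ≡ᵇ toℕ j then c fzero else 0)
                    + sumFin k (λ u → if toℕ (g u) ≡ᵇ toℕ j then c (fsuc u) else 0)
                  ≡ sumFin (suc k) (λ u → if toℕ (extend a g u) ≡ᵇ toℕ j then c u else 0)
  pointwise j = sym (sumFin-suc k (λ u → if toℕ (extend a g u) ≡ᵇ toℕ j then c u else 0))

eqList-expOf-extend : {k N : ℕ} (c : Fin (suc k) → ℕ) (a : Fin N) (g : Fin k → Fin N) (e : List ℕ) →
  eqList (expOf c (extend a g)) e
    ≡ (single a (c fzero) ≤ᵛ e) ∧ eqList (expOf (c ∘ fsuc) g) (e ∸ᵛ single a (c fzero))
eqList-expOf-extend {k} {N} c a g e rewrite expOf-extend c a g =
  eqList-+ᵛ (single a (c fzero)) (expOf (c ∘ fsuc) g) e (length-map-map _ _ (allFin N))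

expOf-empty : {N : ℕ} (c : Fin 0 → ℕ) (g : Fin 0 → Fin N) → expOf c g ≡ zeros N
expOf-empty {N} c g = map-cong (λ j → refl) (allFin N)

-- `allPairs` filters with a local function of Defs that cannot be named here;
-- abstracting over `allFin k` lets unification recover it as `pairsAbove`.
mutual
  pairsAbove : (k : ℕ) → Fin k → List (Fin k) → List (Fin k)
  pairsAbove = _

  allPairs-unfold : (k : ℕ) →
    allPairs k ≡ concatMap (λ i → map (λ j → i , j) (pairsAbove k i (allFin k))) (allFin k)
  allPairs-unfold k with allFin k
  ... | xs = refl

all-++ : {A : Set} (P : A → Bool) (L M : List A) → all P (L ++ M) ≡ all P L ∧ all P M
all-++ P []      M = refl
all-++ P (x ∷ L) M rewrite all-++ P L M = sym (∧-assoc (P x) (all P L) (all P M))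

all-concatMap : {A B : Set} (P : B → Bool) (h : A → List B) (L : List A) →
                all P (concatMap h L) ≡ all (λ a → all P (h a)) L
all-concatMap P h []      = refl
all-concatMap P h (x ∷ L) rewrite all-++ P (h x) (concatMap h L) | all-concatMap P h L = refl

all-map : {A B : Set} (P : B → Bool) (f : A → B) (L : List A) → all P (map f L) ≡ all (P ∘ f) L
all-map P f []      = refl
all-map P f (x ∷ L) rewrite all-map P f L = refl

all-cong : {A : Set} {P Q : A → Bool} (L : List A) → All (λ x → P x ≡ Q x) L → all P L ≡ all Q L
all-cong []      []         = refl
all-cong (x ∷ L) (px ∷ pxs) = cong₂ _∧_ px (all-cong L pxs)

all-∈ : {A : Set} (P : A → Bool) (L : List A) → all P L ≡ true → ∀ {x} → x ∈ L → P x ≡ true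
all-∈ P (y ∷ L) e (here refl) = ∧-true₁ e
all-∈ P (y ∷ L) e (there x∈L) = all-∈ P L (∧-true₂ {P y} e) x∈L

all-intro : {A : Set} (P : A → Bool) (L : List A) → (∀ x → P x ≡ true) → all P L ≡ true
all-intro P []      Px = refl
all-intro P (x ∷ L) Px rewrite Px x = all-intro P L Px

all-pairsAbove : (k : ℕ) (i : Fin k) (P : Fin k → Bool) (L : List (Fin k)) →
  all P (pairsAbove k i L) ≡ all (λ j → if toℕ i <ᵇ toℕ j then P j else true) L
all-pairsAbove k i P []      = refl
all-pairsAbove k i P (x ∷ L) with toℕ i <ᵇ toℕ x
... | true  rewrite all-pairsAbove k i P L = refl
... | false = all-pairsAbove k i P L

all-allPairs : (k : ℕ) (P : Fin k × Fin k → Bool) →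
  all P (allPairs k)
    ≡ all (λ i → all (λ j → if toℕ i <ᵇ toℕ j then P (i , j) else true) (allFin k)) (allFin k)
all-allPairs k P rewrite allPairs-unfold k =
  trans (all-concatMap P _ (allFin k))
        (all-cong (allFin k) (All.universal (λ i →
          trans (all-map P (λ j → i , j) (pairsAbove k i (allFin k))) (all-pairsAbove k i _ (allFin k))) _))

Pairwise : {X : Set} {k : ℕ} → (X → X → Bool) → (Fin k → X) → Set
Pairwise T h = ∀ i j → toℕ i < toℕ j → T (h i) (h j) ≡ true

all-allPairs⁻ : (k : ℕ) (P : Fin k × Fin k → Bool) →
  all P (allPairs k) ≡ true → ∀ i j → toℕ i < toℕ j → P (i , j) ≡ true
all-allPairs⁻ k P e i j i<j
  with toℕ i <ᵇ toℕ j | <ᵇ-complete i<j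
     | all-∈ _ (allFin k) (all-∈ _ (allFin k) (trans (sym (all-allPairs k P)) e) (∈-allFin i)) (∈-allFin j)
... | true | _ | Pij = Pij

all-allPairs⁺ : (k : ℕ) (P : Fin k × Fin k → Bool) →
  (∀ i j → toℕ i < toℕ j → P (i , j) ≡ true) → all P (allPairs k) ≡ true
all-allPairs⁺ k P Pij = trans (all-allPairs k P)
  (all-intro _ (allFin k) (λ i → all-intro _ (allFin k) (λ j → guarded i j)))
  where
  guarded : ∀ i j → (if toℕ i <ᵇ toℕ j then P (i , j) else true) ≡ true
  guarded i j with toℕ i <ᵇ toℕ j in eq
  ... | true  = Pij i j (<ᵇ-sound eq)
  ... | false = refl

pairwise-uncons : {X : Set} {k : ℕ} (T : X → X → Bool) (h : Fin (suc (suc k)) → X) →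
  Pairwise T h → (T (h fzero) (h (fsuc fzero)) ≡ true) × Pairwise T (h ∘ fsuc)
pairwise-uncons T h pw = pw fzero (fsuc fzero) (s≤s z≤n) , λ i j i<j → pw (fsuc i) (fsuc j) (s≤s i<j)

pairwise-cons : {X : Set} {k : ℕ} (T : X → X → Bool) →
  (∀ x y z → T x y ≡ true → T y z ≡ true → T x z ≡ true) →
  (h : Fin (suc (suc k)) → X) →
  T (h fzero) (h (fsuc fzero)) ≡ true → Pairwise T (h ∘ fsuc) → Pairwise T h
pairwise-cons T trans h t₀₁ pw fzero    (fsuc fzero)     _         = t₀₁
pairwise-cons T trans h t₀₁ pw fzero    (fsuc (fsuc j))  _         =
  trans _ _ _ t₀₁ (pw fzero (fsuc j) (s≤s z≤n))
pairwise-cons T trans h t₀₁ pw (fsuc i) (fsuc j)         (s≤s i<j) = pw i j i<j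

lex< : ℕ × ℕ → ℕ × ℕ → Bool
lex< (x₁ , g₁) (x₂ , g₂) = (x₁ <ᵇ x₂) ∨ ((x₁ ≡ᵇ x₂) ∧ (g₁ <ᵇ g₂))

lex<-sound : ∀ x₁ g₁ x₂ g₂ → lex< (x₁ , g₁) (x₂ , g₂) ≡ true →
             (x₁ < x₂) ⊎ ((x₁ ≡ x₂) × (g₁ < g₂))
lex<-sound x₁ g₁ x₂ g₂ e with x₁ <ᵇ x₂ in lt
... | true  = inj₁ (<ᵇ-sound lt)
... | false = inj₂ (≡ᵇ-sound (∧-true₁ e) , <ᵇ-sound (∧-true₂ {x₁ ≡ᵇ x₂} e))

lex<-complete : ∀ x₁ g₁ x₂ g₂ → (x₁ < x₂) ⊎ ((x₁ ≡ x₂) × (g₁ < g₂)) →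
                lex< (x₁ , g₁) (x₂ , g₂) ≡ true
lex<-complete x₁ g₁ x₂ g₂ (inj₁ lt) rewrite <ᵇ-complete lt = refl
lex<-complete x₁ g₁ x₂ g₂ (inj₂ (refl , lt))
  rewrite ≡ᵇ-complete {x₁} {x₁} refl | <ᵇ-complete lt = ∨-zeroʳ (x₁ <ᵇ x₁)

lex<-trans : ∀ p q r → lex< p q ≡ true → lex< q r ≡ true → lex< p r ≡ true
lex<-trans (x₁ , g₁) (x₂ , g₂) (x₃ , g₃) p<q q<r
  with lex<-sound x₁ g₁ x₂ g₂ p<q | lex<-sound x₂ g₂ x₃ g₃ q<r
... | inj₁ a          | inj₁ b          = lex<-complete x₁ g₁ x₃ g₃ (inj₁ (<-trans a b))
... | inj₁ a          | inj₂ (refl , b) = lex<-complete x₁ g₁ x₃ g₃ (inj₁ a)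
... | inj₂ (refl , a) | inj₁ b          = lex<-complete x₁ g₁ x₃ g₃ (inj₁ b)
... | inj₂ (refl , a) | inj₂ (refl , b) = lex<-complete x₁ g₁ x₃ g₃ (inj₂ (refl , <-trans a b))

stepAllowed : {N : ℕ} → Fin N → Fin N → Bool → Bool
stepAllowed a b t = (toℕ a <ᵇ toℕ b) ∨ ((toℕ a ≡ᵇ toℕ b) ∧ t)

isPartition-extend₂ : {k N : ℕ} (γ : Fin (suc (suc k)) → ℕ) (a b : Fin N) (g : Fin k → Fin N) →
  isPartition γ (extend a (extend b g))
    ≡ stepAllowed a b (γ fzero <ᵇ γ (fsuc fzero)) ∧ isPartition (γ ∘ fsuc) (extend b g)
isPartition-extend₂ {k} {N} γ a b g = bool-ext to from
  where
  h : Fin (suc (suc k)) → ℕ × ℕ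
  h u = toℕ (extend a (extend b g) u) , γ u
  to : isPartition γ (extend a (extend b g)) ≡ true →
       stepAllowed a b (γ fzero <ᵇ γ (fsuc fzero)) ∧ isPartition (γ ∘ fsuc) (extend b g) ≡ true
  to e with pairwise-uncons lex< h (all-allPairs⁻ _ _ e)
  ... | t₀₁ , pw rewrite t₀₁ = all-allPairs⁺ _ _ pw
  from : stepAllowed a b (γ fzero <ᵇ γ (fsuc fzero)) ∧ isPartition (γ ∘ fsuc) (extend b g) ≡ true →
         isPartition γ (extend a (extend b g)) ≡ true
  from e = all-allPairs⁺ _ _ (pairwise-cons lex< lex<-trans h (∧-true₁ e)
             (all-allPairs⁻ _ _ (∧-true₂ {stepAllowed a b (γ fzero <ᵇ γ (fsuc fzero))} e)))

strictlyIncr-extend₂ : {k N : ℕ} (a b : Fin N) (g : Fin k → Fin N) →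
  strictlyIncr (extend a (extend b g)) ≡ stepAllowed a b false ∧ strictlyIncr (extend b g)
strictlyIncr-extend₂ {k} {N} a b g
  rewrite ∧-zeroʳ (toℕ a ≡ᵇ toℕ b) | ∨-identityʳ (toℕ a <ᵇ toℕ b) = bool-ext to from
  where
  h : Fin (suc (suc k)) → ℕ
  h u = toℕ (extend a (extend b g) u)
  to : strictlyIncr (extend a (extend b g)) ≡ true → (toℕ a <ᵇ toℕ b) ∧ strictlyIncr (extend b g) ≡ true
  to e with pairwise-uncons _<ᵇ_ h (all-allPairs⁻ _ _ e)
  ... | t₀₁ , pw rewrite t₀₁ = all-allPairs⁺ _ _ pw
  from : (toℕ a <ᵇ toℕ b) ∧ strictlyIncr (extend b g) ≡ true → strictlyIncr (extend a (extend b g)) ≡ true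
  from e = all-allPairs⁺ _ _ (pairwise-cons _<ᵇ_ <ᵇ-trans h (∧-true₁ e)
             (all-allPairs⁻ _ _ (∧-true₂ {toℕ a <ᵇ toℕ b} e)))

-- Number of fillings f of a chain with weights ws that start at f(u₁) = a, have exponent
-- vector e, and step from f(u_j) to f(u_{j+1}) as allowed by the j-th flag of ts.
fillingsFrom : {N : ℕ} → List ℕ → List Bool → Fin N → List ℕ → ℕ
fillingsFrom         []          ts       a e = 0
fillingsFrom {N}     (x ∷ [])    ts       a e = ⟦ single a x ≤ᵛ e ∧ eqList (zeros N) (e ∸ᵛ single a x) ⟧
fillingsFrom         (x ∷ y ∷ r) []       a e = 0
fillingsFrom {N}     (x ∷ y ∷ r) (t ∷ ts) a e =
  ⟦ single a x ≤ᵛ e ⟧ * sumFin N (λ b → ⟦ stepAllowed a b t ⟧ * fillingsFrom (y ∷ r) ts b (e ∸ᵛ single a x))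

countFrom : {k N : ℕ} → ((Fin (suc k) → Fin N) → Bool) → (Fin (suc k) → ℕ) → Fin N → List ℕ → ℕ
countFrom {k} {N} P c a e = countB (λ g → P (extend a g) ∧ eqList (expOf c (extend a g)) e) (allFuns k N)

countFrom-extend₂ : {k N : ℕ} (P : (Fin (suc (suc k)) → Fin N) → Bool) (Q : (Fin (suc k) → Fin N) → Bool)
  (t : Bool) → (∀ a b g → P (extend a (extend b g)) ≡ stepAllowed a b t ∧ Q (extend b g)) →
  (c : Fin (suc (suc k)) → ℕ) (a : Fin N) (e : List ℕ) →
  countFrom P c a e
    ≡ ⟦ single a (c fzero) ≤ᵛ e ⟧
      * sumFin N (λ b → ⟦ stepAllowed a b t ⟧ * countFrom Q (c ∘ fsuc) b (e ∸ᵛ single a (c fzero)))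
countFrom-extend₂ {k} {N} P Q t P-split c a e = begin
    countFrom P c a e
      ≡⟨ countB-allFuns-suc k N _ ⟩
    sumFin N (λ b → countB (λ g → P (extend a (extend b g)) ∧ eqList (expOf c (extend a (extend b g))) e)
                           (allFuns k N))
      ≡⟨ sumOver-cong (allFin N) (λ b → countB-cong (allFuns k N) (λ g →
           trans (cong₂ _∧_ (P-split a b g) (eqList-expOf-extend c a (extend b g) e))
                 (regroup (step b) (Q (extend b g)) fits _))) ⟩
    sumFin N (λ b → countB (λ g → step b ∧ (fits ∧ rest b g)) (allFuns k N))
      ≡⟨ sumOver-cong (allFin N) (λ b → trans (countB-const∧ (allFuns k N) (step b) _)
                                              (cong (⟦ step b ⟧ *_) (countB-const∧ (allFuns k N) fits _))) ⟩
    sumFin N (λ b → ⟦ step b ⟧ * (⟦ fits ⟧ * countFrom Q (c ∘ fsuc) b e′))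
      ≡⟨ sumOver-cong (allFin N) (λ b → *-exchangeˡ ⟦ step b ⟧ ⟦ fits ⟧ _) ⟩
    sumFin N (λ b → ⟦ fits ⟧ * (⟦ step b ⟧ * countFrom Q (c ∘ fsuc) b e′))
      ≡⟨ sumOver-*ˡ (allFin N) ⟦ fits ⟧ _ ⟩
    ⟦ fits ⟧ * sumFin N (λ b → ⟦ step b ⟧ * countFrom Q (c ∘ fsuc) b e′) ∎
  where
  open ≡-Reasoning
  step : Fin N → Bool
  step b = stepAllowed a b t
  fits : Bool
  fits = single a (c fzero) ≤ᵛ e
  e′ : List ℕ
  e′ = e ∸ᵛ single a (c fzero)
  rest : Fin N → (Fin k → Fin N) → Bool
  rest b g = Q (extend b g) ∧ eqList (expOf (c ∘ fsuc) (extend b g)) e′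
  regroup : ∀ s q l r → (s ∧ q) ∧ (l ∧ r) ≡ s ∧ (l ∧ (q ∧ r))
  regroup s q l r = trans (∧-interchange s q l r) (∧-assoc s l (q ∧ r))

ascents : (k : ℕ) → (Fin (suc k) → ℕ) → List Bool
ascents zero    γ = []
ascents (suc k) γ = (γ fzero <ᵇ γ (fsuc fzero)) ∷ ascents k (γ ∘ fsuc)

countFrom-isPartition : {N : ℕ} (k : ℕ) (γ w : Fin (suc k) → ℕ) (a : Fin N) (e : List ℕ) →
  countFrom (isPartition γ) w a e ≡ fillingsFrom (tabulate w) (ascents k γ) a e
countFrom-isPartition {N} zero γ w a e =
  trans (+-identityʳ _) (cong ⟦_⟧ (eqList-expOf-extend {0} {N} w a (λ ()) e))
countFrom-isPartition {N} (suc k) γ w a e =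
  trans (countFrom-extend₂ (isPartition γ) (isPartition (γ ∘ fsuc)) _ (isPartition-extend₂ γ) w a e)
        (cong (⟦ single a (w fzero) ≤ᵛ e ⟧ *_) (sumOver-cong (allFin N) (λ b →
          cong (⟦ stepAllowed a b (γ fzero <ᵇ γ (fsuc fzero)) ⟧ *_)
               (countFrom-isPartition k (γ ∘ fsuc) (w ∘ fsuc) b (e ∸ᵛ single a (w fzero))))))

mFrom : {N : ℕ} → List ℕ → Fin N → List ℕ → ℕ
mFrom β = fillingsFrom β (replicate (length β) false)

countFrom-strictlyIncr : {N : ℕ} (c : ℕ) (β : List ℕ) (a : Fin N) (e : List ℕ) →
  countFrom {length β} strictlyIncr (λ t → lookupL (c ∷ β) (toℕ t)) a e ≡ mFrom (c ∷ β) a e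
countFrom-strictlyIncr {N} c [] a e =
  trans (+-identityʳ _) (cong ⟦_⟧ (eqList-expOf-extend {0} {N} (λ t → lookupL (c ∷ []) (toℕ t)) a (λ ()) e))
countFrom-strictlyIncr {N} c (c′ ∷ β) a e =
  trans (countFrom-extend₂ strictlyIncr strictlyIncr false strictlyIncr-extend₂ _ a e)
        (cong (⟦ single a c ≤ᵛ e ⟧ *_) (sumOver-cong (allFin N) (λ b →
          cong (⟦ stepAllowed a b false ⟧ *_) (countFrom-strictlyIncr c′ β b (e ∸ᵛ single a c)))))

K-byFirstValue : (k : ℕ) (γ w : Fin (suc k) → ℕ) (e : List ℕ) →
  K γ w e ≡ sumFin (length e) (λ a → fillingsFrom (tabulate w) (ascents k γ) a e)
K-byFirstValue k γ w e =
  trans (countB-allFuns-suc k (length e) _) (sumOver-cong (allFin (length e)) (λ a → countFrom-isPartition k γ w a e))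

M-byFirstValue : (c : ℕ) (β : List ℕ) (e : List ℕ) →
                 M (c ∷ β) e ≡ sumFin (length e) (λ a → mFrom (c ∷ β) a e)
M-byFirstValue c β e =
  trans (countB-allFuns-suc (length β) (length e) _)
        (sumOver-cong (allFin (length e)) (λ a → countFrom-strictlyIncr c β a e))

mFrom-+ : {N : ℕ} (x y : ℕ) (r : List ℕ) (a : Fin N) (e : List ℕ) →
  mFrom ((x + y) ∷ r) a e ≡ ⟦ single a x ≤ᵛ e ⟧ * mFrom (y ∷ r) a (e ∸ᵛ single a x)
mFrom-+ x y [] a e rewrite single-+ᵛ-≤ᵛ a x y e | ∸ᵛ-single-+ a x y e =
  trans (cong ⟦_⟧ (∧-assoc (single a x ≤ᵛ e) _ _)) (⟦∧⟧ (single a x ≤ᵛ e) _)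
mFrom-+ {N} x y (z ∷ r) a e rewrite single-+ᵛ-≤ᵛ a x y e | ∸ᵛ-single-+ a x y e =
  trans (cong (_* rest) (⟦∧⟧ (single a x ≤ᵛ e) _)) (*-assoc ⟦ single a x ≤ᵛ e ⟧ _ rest)
  where
  rest : ℕ
  rest = sumFin N (λ b → ⟦ stepAllowed a b false ⟧ * mFrom (z ∷ r) b (e ∸ᵛ single a x ∸ᵛ single a y))

setAux-+ : ∀ m acc l → setAux (m + acc) l ≡ map (m +_) (setAux acc l)
setAux-+ m acc []          = refl
setAux-+ m acc (a ∷ [])    = refl
setAux-+ m acc (a ∷ b ∷ l) =
  trans (cong (λ z → z ∷ setAux z (b ∷ l)) (+-assoc m acc a))
        (cong ((m + (acc + a)) ∷_) (setAux-+ m (acc + a) (b ∷ l)))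

setAux≡map-setC : ∀ m l → setAux m l ≡ map (m +_) (setC l)
setAux≡map-setC m l = trans (cong (λ z → setAux z l) (sym (+-identityʳ m))) (setAux-+ m 0 l)

setC-∷∷ : ∀ x y r → setC (x ∷ y ∷ r) ≡ x ∷ map (x +_) (setC (y ∷ r))
setC-∷∷ x y r = cong (x ∷_) (setAux≡map-setC x (y ∷ r))

setC-+head : ∀ m x r → setC ((m + x) ∷ r) ≡ map (m +_) (setC (x ∷ r))
setC-+head m x []      = refl
setC-+head m x (y ∷ r) = begin
  setC ((m + x) ∷ y ∷ r)                          ≡⟨ setC-∷∷ (m + x) y r ⟩
  (m + x) ∷ map ((m + x) +_) (setC (y ∷ r))       ≡⟨ cong ((m + x) ∷_) (trans (map-cong (+-assoc m x) (setC (y ∷ r)))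
                                                                              (map-∘ (setC (y ∷ r)))) ⟩
  (m + x) ∷ map (m +_) (map (x +_) (setC (y ∷ r))) ≡⟨ cong (map (m +_)) (sym (setC-∷∷ x y r)) ⟩
  map (m +_) (setC (x ∷ y ∷ r))                   ∎
  where open ≡-Reasoning

setAux-lowerBound : ∀ acc x l → All (acc + x ≤_) (setAux acc (x ∷ l))
setAux-lowerBound acc x []      = []
setAux-lowerBound acc x (y ∷ l) =
  ≤-refl ∷ All.map (≤-trans (m≤m+n (acc + x) y)) (setAux-lowerBound (acc + x) y l)

setC-positive : ∀ x r → 1 ≤ x → All (1 ≤_) (setC (x ∷ r))
setC-positive x r 1≤x = All.map (≤-trans 1≤x) (setAux-lowerBound 0 x r)

+≡ᵇ+ : ∀ m y z → (m + y ≡ᵇ m + z) ≡ (y ≡ᵇ z)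
+≡ᵇ+ zero    y z = refl
+≡ᵇ+ (suc m) y z = +≡ᵇ+ m y z

memB-map-+ : ∀ m y L → memB (m + y) (map (m +_) L) ≡ memB y L
memB-map-+ m y []      = refl
memB-map-+ m y (z ∷ L) rewrite +≡ᵇ+ m y z | memB-map-+ m y L = refl

memB-∷-map-+ : ∀ m y L → 1 ≤ y → memB (m + y) (m ∷ map (m +_) L) ≡ memB y L
memB-∷-map-+ m (suc y) L _ rewrite ≢⇒≡ᵇ-false {m + suc y} {m} (m+1+n≢m m) = memB-map-+ m (suc y) L

memB-head : ∀ x L → memB x (x ∷ L) ≡ true
memB-head x L rewrite ≡ᵇ-complete {x} {x} refl = refl

memB-belowAll : ∀ p L → All (p <_) L → memB p L ≡ false
memB-belowAll p []      []           = refl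
memB-belowAll p (z ∷ L) (p<z ∷ p<L) rewrite ≢⇒≡ᵇ-false {p} {z} (<⇒≢ p<z) = memB-belowAll p L p<L

memB-sound : ∀ p L → memB p L ≡ true → p ∈ L
memB-sound p (z ∷ L) e with p ≡ᵇ z in eq
... | true  = here (≡ᵇ-sound eq)
... | false = there (memB-sound p L e)

sumComps : ℕ → (List ℕ → ℕ) → ℕ
sumComps n = sumOver (compositions n)

sumChildren : (List ℕ → ℕ) → List ℕ → ℕ
sumChildren G c = G (1 ∷ c) + sumOver (incFirst c) G

sumComps-suc : ∀ n G → sumComps (suc n) G ≡ sumComps n (sumChildren G)
sumComps-suc n G = sumOver-concatMap (compositions n) (λ c → (1 ∷ c) ∷ incFirst c) G

sumDescendants : ℕ → (List ℕ → ℕ) → List ℕ → ℕ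
sumDescendants zero    G = G
sumDescendants (suc m) G = sumDescendants m (sumChildren G)

sumComps-+ : ∀ m n G → sumComps (m + n) G ≡ sumComps n (sumDescendants m G)
sumComps-+ zero    n G = refl
sumComps-+ (suc m) n G = trans (sumComps-suc (m + n) G) (sumComps-+ m n (sumChildren G))

Positive : List ℕ → Set
Positive = All (1 ≤_)

sumComps-cong : ∀ n G G′ → (∀ c → Positive c → sum c ≡ n → G c ≡ G′ c) →
                sumComps n G ≡ sumComps n G′
sumComps-cong zero    G G′ G≗G′ = cong (_+ 0) (G≗G′ [] [] refl)
sumComps-cong (suc n) G G′ G≗G′ =
  trans (sumComps-suc n G) (trans (sumComps-cong n (sumChildren G) (sumChildren G′) children)
                                  (sym (sumComps-suc n G′)))
  where
  children : ∀ c → Positive c → sum c ≡ n → sumChildren G c ≡ sumChildren G′ c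
  children []      _          Σc = cong (_+ 0) (G≗G′ (1 ∷ []) (s≤s z≤n ∷ []) (cong suc Σc))
  children (x ∷ r) (px ∷ pr) Σc = cong₂ _+_ (G≗G′ (1 ∷ x ∷ r) (s≤s z≤n ∷ px ∷ pr) (cong suc Σc))
                                             (cong (_+ 0) (G≗G′ (suc x ∷ r) (s≤s z≤n ∷ pr) (cong suc Σc)))

VanishesBelow : ℕ → (List ℕ → ℕ) → Set
VanishesBelow a G = ∀ β p → 1 ≤ p → p < a → memB p (setC β) ≡ true → G β ≡ 0

mergeFirst : ℕ → List ℕ → List (List ℕ)
mergeFirst a []      = []
mergeFirst a (x ∷ r) = ((a + x) ∷ r) ∷ []

vanishesBelow-sumChildren : ∀ a G → VanishesBelow (suc a) G → VanishesBelow a (sumChildren G)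
vanishesBelow-sumChildren a G G0 (x ∷ y ∷ r) p 1≤p p<a p∈ = cong₂ _+_ prepend (cong (_+ 0) increment)
  where
  prepend : G (1 ∷ x ∷ y ∷ r) ≡ 0
  prepend = G0 _ (suc p) (s≤s z≤n) (s≤s p<a)
    (trans (cong (memB (suc p)) (setC-∷∷ 1 x (y ∷ r))) (trans (memB-∷-map-+ 1 p (setC (x ∷ y ∷ r)) 1≤p) p∈))
  increment : G (suc x ∷ y ∷ r) ≡ 0
  increment = G0 _ (suc p) (s≤s z≤n) (s≤s p<a)
    (trans (cong (memB (suc p)) (setC-+head 1 x (y ∷ r))) (trans (memB-map-+ 1 p (setC (x ∷ y ∷ r))) p∈))

-- A descendant of c whose partial sums avoid [1, m) has first part m followed by c,
-- or first part m + c₁ followed by the rest of c.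
sumDescendants-vanishing : ∀ m G c → 1 ≤ m → VanishesBelow m G →
  sumDescendants m G c ≡ G (m ∷ c) + sumOver (mergeFirst m c) G
sumDescendants-vanishing (suc zero)    G []      _ _  = refl
sumDescendants-vanishing (suc zero)    G (x ∷ r) _ _  = refl
sumDescendants-vanishing (suc (suc a)) G c       _ G0 =
  trans (sumDescendants-vanishing (suc a) (sumChildren G) c (s≤s z≤n) (vanishesBelow-sumChildren (suc a) G G0))
        (lastStep c)
  where
  startsWith1 : ∀ y c → G (1 ∷ y ∷ c) ≡ 0
  startsWith1 y c = G0 (1 ∷ y ∷ c) 1 (s≤s z≤n) (s≤s (s≤s z≤n)) refl
  lastStep : ∀ c → sumChildren G (suc a ∷ c) + sumOver (mergeFirst (suc a) c) (sumChildren G)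
                 ≡ G (suc (suc a) ∷ c) + sumOver (mergeFirst (suc (suc a)) c) G
  lastStep []      rewrite startsWith1 (suc a) [] = +-identityʳ _
  lastStep (x ∷ r) rewrite startsWith1 (suc a) (x ∷ r) | startsWith1 (suc a + x) r =
    cong₂ _+_ (+-identityʳ (G (suc (suc a) ∷ x ∷ r))) (+-identityʳ (G (suc (suc a + x) ∷ r) + 0))

SortedFrom : ℕ → List ℕ → Set
SortedFrom m []       = ⊤
SortedFrom m (x ∷ xs) = (m ≤ x) × SortedFrom x xs

sortedFrom-weaken : ∀ {m m′} L → m ≤ m′ → SortedFrom m′ L → SortedFrom m L
sortedFrom-weaken []      m≤m′ _         = tt
sortedFrom-weaken (x ∷ L) m≤m′ (m′≤x , s) = ≤-trans m≤m′ m′≤x , s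

setAux-diffs : ∀ prev S n → SortedFrom prev S → setAux prev (diffs prev S n) ≡ S
setAux-diffs prev []          n _            = refl
setAux-diffs prev (x ∷ [])    n (prev≤x , _) = cong (_∷ []) (m+[n∸m]≡n prev≤x)
setAux-diffs prev (x ∷ y ∷ S) n (prev≤x , s) =
  trans (cong (λ z → z ∷ setAux z (diffs x (y ∷ S) n)) (m+[n∸m]≡n prev≤x))
        (cong (x ∷_) (setAux-diffs x (y ∷ S) n s))

descAux-sorted : ∀ acc w₁ g₁ r → SortedFrom acc (descAux acc (w₁ , g₁) r)
descAux-sorted acc w₁ g₁ []               = tt
descAux-sorted acc w₁ g₁ ((w₂ , g₂) ∷ r) with g₂ <ᵇ g₁
... | true  = m≤m+n acc w₁ , descAux-sorted (acc + w₁) w₂ g₂ r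
... | false = sortedFrom-weaken (descAux (acc + w₁) (w₂ , g₂) r) (m≤m+n acc w₁)
                                (descAux-sorted (acc + w₁) w₂ g₂ r)

descAux-lowerBound : ∀ acc w₁ g₁ r → All (acc + w₁ ≤_) (descAux acc (w₁ , g₁) r)
descAux-lowerBound acc w₁ g₁ []               = []
descAux-lowerBound acc w₁ g₁ ((w₂ , g₂) ∷ r) with g₂ <ᵇ g₁
... | true  = ≤-refl ∷ All.map (≤-trans (m≤m+n (acc + w₁) w₂)) (descAux-lowerBound (acc + w₁) w₂ g₂ r)
... | false = All.map (≤-trans (m≤m+n (acc + w₁) w₂)) (descAux-lowerBound (acc + w₁) w₂ g₂ r)

descAux-+ : ∀ m acc p r → descAux (m + acc) p r ≡ map (m +_) (descAux acc p r)
descAux-+ m acc p                []               = refl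
descAux-+ m acc (w₁ , g₁) ((w₂ , g₂) ∷ r) with g₂ <ᵇ g₁
... | true  = trans (cong (λ z → z ∷ descAux z (w₂ , g₂) r) (+-assoc m acc w₁))
                    (cong ((m + (acc + w₁)) ∷_) (descAux-+ m (acc + w₁) (w₂ , g₂) r))
... | false = trans (cong (λ z → descAux z (w₂ , g₂) r) (+-assoc m acc w₁))
                    (descAux-+ m (acc + w₁) (w₂ , g₂) r)

descAux≡map-descAux₀ : ∀ m p r → descAux m p r ≡ map (m +_) (descAux 0 p r)
descAux≡map-descAux₀ m p r = trans (cong (λ z → descAux z p r) (sym (+-identityʳ m))) (descAux-+ m 0 p r)

descentSet : (k : ℕ) → (γ w : Fin (suc k) → ℕ) → List ℕ
descentSet k γ w = descAux 0 (w fzero , γ fzero) (zip (tabulate (w ∘ fsuc)) (tabulate (γ ∘ fsuc)))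

setC-deltaC : (k : ℕ) (γ w : Fin (suc k) → ℕ) → 1 ≤ w fzero → setC (deltaC γ w) ≡ descentSet k γ w
setC-deltaC k γ w 1≤w₀ = setC-comp (weight w) (≤-trans 1≤w₀ (m≤m+n (w fzero) (weight (w ∘ fsuc))))
  where
  setC-comp : ∀ n → 1 ≤ n → setC (comp n (descentSet k γ w)) ≡ descentSet k γ w
  setC-comp (suc n) _ = setAux-diffs 0 (descentSet k γ w) (suc n)
    (descAux-sorted 0 (w fzero) (γ fzero) (zip (tabulate (w ∘ fsuc)) (tabulate (γ ∘ fsuc))))

inInterval : {ℓ : ℕ} (γ w : Fin ℓ → ℕ) → List ℕ → Bool
inInterval γ w β = (alphaC w ≼ β) ∧ (β ≼ deltaC γ w)

-- As for `allPairs`, the filter inside `interval` is recovered by unification.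
mutual
  intervalFilter : {ℓ : ℕ} (γ w : Fin ℓ → ℕ) → List (List ℕ) → List (List ℕ)
  intervalFilter = _

  interval-unfold : {ℓ : ℕ} (γ w : Fin ℓ → ℕ) →
                    interval γ w ≡ intervalFilter γ w (compositions (weight w))
  interval-unfold γ w with compositions (foldr _+_ 0 (tabulate w))
  ... | xs = refl

sumOver-intervalFilter : {ℓ : ℕ} (γ w : Fin ℓ → ℕ) (L : List (List ℕ)) (F : List ℕ → ℕ) →
  sumOver (intervalFilter γ w L) F ≡ sumOver L (λ β → ⟦ inInterval γ w β ⟧ * F β)
sumOver-intervalFilter γ w []      F = refl
sumOver-intervalFilter γ w (β ∷ L) F with inInterval γ w β
... | true  = cong₂ _+_ (sym (+-identityʳ (F β))) (sumOver-intervalFilter γ w L F)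
... | false = sumOver-intervalFilter γ w L F

sumOver-interval : {ℓ : ℕ} (γ w : Fin ℓ → ℕ) (F : List ℕ → ℕ) →
  sumOver (interval γ w) F ≡ sumComps (weight w) (λ β → ⟦ inInterval γ w β ⟧ * F β)
sumOver-interval γ w F rewrite interval-unfold γ w = sumOver-intervalFilter γ w (compositions (weight w)) F

-- The least element of set(α(s,w)) is w(u₁), and β ≽ α forces set(β) ⊆ set(α).
inInterval-vanishesBelow : (k : ℕ) (γ w : Fin (suc k) → ℕ) (F : List ℕ → ℕ) →
  VanishesBelow (w fzero) (λ β → ⟦ inInterval γ w β ⟧ * F β)
inInterval-vanishesBelow k γ w F β p _ p<w₀ p∈β with all (λ x → memB x (setC (alphaC w))) (setC β) in α≼β
... | false = refl
... | true
  with trans (sym (memB-belowAll p _ (All.map (<-≤-trans p<w₀) (setAux-lowerBound 0 (w fzero) (tabulate (w ∘ fsuc))))))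
             (all-∈ _ (setC β) α≼β (memB-sound p (setC β) p∈β))
...   | ()

inInterval-viaSets : {ℓ : ℕ} (γ w : Fin ℓ → ℕ) (β SB SA SD : List ℕ) →
  setC β ≡ SB → setC (alphaC w) ≡ SA → setC (deltaC γ w) ≡ SD →
  inInterval γ w β ≡ all (λ y → memB y SA) SB ∧ all (λ d → memB d SB) SD
inInterval-viaSets γ w β SB SA SD refl refl refl = refl

all-memB-shift : ∀ m S T → All (1 ≤_) S →
  all (λ y → memB y (m ∷ map (m +_) T)) (map (m +_) S) ≡ all (λ y → memB y T) S
all-memB-shift m S T pos = trans (all-map _ (m +_) S) (all-cong S (All.map (λ {y} → memB-∷-map-+ m y T) pos))

all-memB-shift-∷ : ∀ m S T → All (1 ≤_) S →
  all (λ y → memB y (m ∷ map (m +_) T)) (m ∷ map (m +_) S) ≡ all (λ y → memB y T) S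
all-memB-shift-∷ m S T pos rewrite memB-head m (map (m +_) T) = all-memB-shift m S T pos

all-memB-map-+ : ∀ m S T → all (λ d → memB d (map (m +_) S)) (map (m +_) T) ≡ all (λ d → memB d S) T
all-memB-map-+ m S T = trans (all-map _ (m +_) T) (all-cong T (All.universal (λ d → memB-map-+ m d S) T))

module ChainStep (k : ℕ) (γ w : Fin (suc (suc k)) → ℕ) (pos : ∀ u → 1 ≤ w u) where

  w₀ γ₀ γ₁ : ℕ
  w₀ = w fzero
  γ₀ = γ fzero
  γ₁ = γ (fsuc fzero)

  γ′ w′ : Fin (suc k) → ℕ
  γ′ = γ ∘ fsuc
  w′ = w ∘ fsuc

  rest′ : List (ℕ × ℕ)
  rest′ = zip (tabulate (w′ ∘ fsuc)) (tabulate (γ′ ∘ fsuc))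

  A′ D′ : List ℕ
  A′ = setC (alphaC w′)
  D′ = descentSet k γ′ w′

  setC-alphaC : setC (alphaC w) ≡ w₀ ∷ map (w₀ +_) A′
  setC-alphaC = setC-∷∷ w₀ (w′ fzero) (tabulate (w′ ∘ fsuc))

  setC-deltaC-descent : (γ₁ <ᵇ γ₀) ≡ true → setC (deltaC γ w) ≡ w₀ ∷ map (w₀ +_) D′
  setC-deltaC-descent desc rewrite setC-deltaC (suc k) γ w (pos fzero) | desc =
    cong (w₀ ∷_) (descAux≡map-descAux₀ w₀ (w′ fzero , γ₁) rest′)

  setC-deltaC-ascent : (γ₁ <ᵇ γ₀) ≡ false → setC (deltaC γ w) ≡ map (w₀ +_) D′
  setC-deltaC-ascent asc rewrite setC-deltaC (suc k) γ w (pos fzero) | asc =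
    descAux≡map-descAux₀ w₀ (w′ fzero , γ₁) rest′

  D′-positive : All (1 ≤_) D′
  D′-positive = All.map (≤-trans (pos (fsuc fzero))) (descAux-lowerBound 0 (w′ fzero) γ₁ rest′)

  inInterval′ : ∀ c → inInterval γ′ w′ c ≡ all (λ y → memB y A′) (setC c) ∧ all (λ d → memB d (setC c)) D′
  inInterval′ c =
    inInterval-viaSets γ′ w′ c (setC c) A′ D′ refl refl (setC-deltaC k γ′ w′ (pos (fsuc fzero)))

  inInterval-∷ : ∀ x r → 1 ≤ x → inInterval γ w (w₀ ∷ x ∷ r) ≡ inInterval γ′ w′ (x ∷ r)
  inInterval-∷ x r 1≤x = byDescent (γ₁ <ᵇ γ₀) refl
    where
    S : List ℕ
    S = setC (x ∷ r)
    S-positive : All (1 ≤_) S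
    S-positive = setC-positive x r 1≤x
    byDescent : ∀ b → (γ₁ <ᵇ γ₀) ≡ b → inInterval γ w (w₀ ∷ x ∷ r) ≡ inInterval γ′ w′ (x ∷ r)
    byDescent true desc = begin
      inInterval γ w (w₀ ∷ x ∷ r)
        ≡⟨ inInterval-viaSets γ w _ _ _ _ (setC-∷∷ w₀ x r) setC-alphaC (setC-deltaC-descent desc) ⟩
      all (λ y → memB y (w₀ ∷ map (w₀ +_) A′)) (w₀ ∷ map (w₀ +_) S)
        ∧ (memB w₀ (w₀ ∷ map (w₀ +_) S) ∧ all (λ d → memB d (w₀ ∷ map (w₀ +_) S)) (map (w₀ +_) D′))
        ≡⟨ cong₂ _∧_ (all-memB-shift-∷ w₀ S A′ S-positive)
                     (cong₂ _∧_ (memB-head w₀ (map (w₀ +_) S)) (all-memB-shift w₀ D′ S D′-positive)) ⟩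
      all (λ y → memB y A′) S ∧ all (λ d → memB d S) D′
        ≡⟨ inInterval′ (x ∷ r) ⟨
      inInterval γ′ w′ (x ∷ r) ∎
      where open ≡-Reasoning
    byDescent false asc = begin
      inInterval γ w (w₀ ∷ x ∷ r)
        ≡⟨ inInterval-viaSets γ w _ _ _ _ (setC-∷∷ w₀ x r) setC-alphaC (setC-deltaC-ascent asc) ⟩
      all (λ y → memB y (w₀ ∷ map (w₀ +_) A′)) (w₀ ∷ map (w₀ +_) S)
        ∧ all (λ d → memB d (w₀ ∷ map (w₀ +_) S)) (map (w₀ +_) D′)
        ≡⟨ cong₂ _∧_ (all-memB-shift-∷ w₀ S A′ S-positive) (all-memB-shift w₀ D′ S D′-positive) ⟩
      all (λ y → memB y A′) S ∧ all (λ d → memB d S) D′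
        ≡⟨ inInterval′ (x ∷ r) ⟨
      inInterval γ′ w′ (x ∷ r) ∎
      where open ≡-Reasoning

  -- Merging the first two parts is only allowed across an ascent γ(u₁) < γ(u₂), which by
  -- injectivity of γ is exactly the absence of a descent.
  inInterval-+head : Injective _≡_ _≡_ γ → ∀ x r → 1 ≤ x →
    inInterval γ w ((w₀ + x) ∷ r) ≡ (γ₀ <ᵇ γ₁) ∧ inInterval γ′ w′ (x ∷ r)
  inInterval-+head inj x r 1≤x = byDescent (γ₁ <ᵇ γ₀) refl
    where
    S : List ℕ
    S = setC (x ∷ r)
    S-positive : All (1 ≤_) S
    S-positive = setC-positive x r 1≤x
    byDescent : ∀ b → (γ₁ <ᵇ γ₀) ≡ b →
                inInterval γ w ((w₀ + x) ∷ r) ≡ (γ₀ <ᵇ γ₁) ∧ inInterval γ′ w′ (x ∷ r)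
    byDescent true desc = begin
      inInterval γ w ((w₀ + x) ∷ r)
        ≡⟨ inInterval-viaSets γ w _ _ _ _ (setC-+head w₀ x r) setC-alphaC (setC-deltaC-descent desc) ⟩
      αPart ∧ (memB w₀ (map (w₀ +_) S) ∧ all (λ d → memB d (map (w₀ +_) S)) (map (w₀ +_) D′))
        ≡⟨ cong (λ b → αPart ∧ (b ∧ all (λ d → memB d (map (w₀ +_) S)) (map (w₀ +_) D′))) w₀∉β ⟩
      αPart ∧ false
        ≡⟨ ∧-zeroʳ αPart ⟩
      false
        ≡⟨ cong (_∧ inInterval γ′ w′ (x ∷ r)) (≮⇒<ᵇ-false (<-asym (<ᵇ-sound {γ₁} {γ₀} desc))) ⟨
      (γ₀ <ᵇ γ₁) ∧ inInterval γ′ w′ (x ∷ r) ∎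
      where
      open ≡-Reasoning
      αPart : Bool
      αPart = all (λ y → memB y (w₀ ∷ map (w₀ +_) A′)) (map (w₀ +_) S)
      w₀∉β : memB w₀ (map (w₀ +_) S) ≡ false
      w₀∉β = trans (cong (λ z → memB z (map (w₀ +_) S)) (sym (+-identityʳ w₀)))
                   (trans (memB-map-+ w₀ 0 S) (memB-belowAll 0 S S-positive))
    byDescent false asc = begin
      inInterval γ w ((w₀ + x) ∷ r)
        ≡⟨ inInterval-viaSets γ w _ _ _ _ (setC-+head w₀ x r) setC-alphaC (setC-deltaC-ascent asc) ⟩
      all (λ y → memB y (w₀ ∷ map (w₀ +_) A′)) (map (w₀ +_) S)
        ∧ all (λ d → memB d (map (w₀ +_) S)) (map (w₀ +_) D′)
        ≡⟨ cong₂ _∧_ (all-memB-shift w₀ S A′ S-positive) (all-memB-map-+ w₀ S D′) ⟩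
      all (λ y → memB y A′) S ∧ all (λ d → memB d S) D′
        ≡⟨ inInterval′ (x ∷ r) ⟨
      inInterval γ′ w′ (x ∷ r)
        ≡⟨ cong (_∧ inInterval γ′ w′ (x ∷ r)) γ₀<γ₁ ⟨
      (γ₀ <ᵇ γ₁) ∧ inInterval γ′ w′ (x ∷ r) ∎
      where
      open ≡-Reasoning
      γ₀<γ₁ : (γ₀ <ᵇ γ₁) ≡ true
      γ₀<γ₁ = <ᵇ-complete (≤∧≢⇒< (≮⇒≥ (<ᵇ-false⇒≮ asc)) (λ γ₀≡γ₁ → 0≢1+n (cong toℕ (inj γ₀≡γ₁))))

intervalTerm : {ℓ N : ℕ} (γ w : Fin ℓ → ℕ) → Fin N → List ℕ → List ℕ → ℕ
intervalTerm γ w a e β = ⟦ inInterval γ w β ⟧ * mFrom β a e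

stepAllowed-split : {N : ℕ} (a b : Fin N) (t : Bool) →
  ⟦ stepAllowed a b t ⟧ ≡ ⟦ stepAllowed a b false ⟧ + ⟦ t ⟧ * ⟦ toℕ a ≡ᵇ toℕ b ⟧
stepAllowed-split a b t with toℕ a <ᵇ toℕ b in a<b
... | true rewrite ≢⇒≡ᵇ-false {toℕ a} {toℕ b} (<⇒≢ (<ᵇ-sound a<b)) | *-zeroʳ ⟦ t ⟧ = refl
... | false with toℕ a ≡ᵇ toℕ b | t
...   | true  | true  = refl
...   | true  | false = refl
...   | false | true  = refl
...   | false | false = refl

sumFin-stepAllowed : (N : ℕ) (a : Fin N) (t : Bool) (X : Fin N → ℕ) →
  sumFin N (λ b → ⟦ stepAllowed a b t ⟧ * X b)
    ≡ sumFin N (λ b → ⟦ stepAllowed a b false ⟧ * X b) + ⟦ t ⟧ * X a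
sumFin-stepAllowed N a t X = begin
    sumFin N (λ b → ⟦ stepAllowed a b t ⟧ * X b)
      ≡⟨ sumOver-cong (allFin N) (λ b → trans (cong (_* X b) (stepAllowed-split a b t))
                                              (*-distribʳ-+ (X b) ⟦ stepAllowed a b false ⟧ _)) ⟩
    sumFin N (λ b → ⟦ stepAllowed a b false ⟧ * X b + ⟦ t ⟧ * ⟦ toℕ a ≡ᵇ toℕ b ⟧ * X b)
      ≡⟨ sumOver-+ (allFin N) _ _ ⟩
    sumFin N (λ b → ⟦ stepAllowed a b false ⟧ * X b) + sumFin N (λ b → ⟦ t ⟧ * ⟦ toℕ a ≡ᵇ toℕ b ⟧ * X b)
      ≡⟨ cong (sumFin N (λ b → ⟦ stepAllowed a b false ⟧ * X b) +_) (trans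
           (sumOver-cong (allFin N) (λ b → trans (*-assoc ⟦ t ⟧ _ (X b))
                                                 (*-exchangeˡ ⟦ t ⟧ ⟦ toℕ a ≡ᵇ toℕ b ⟧ (X b))))
           (sumFin-δ N a (λ b → ⟦ t ⟧ * X b))) ⟩
    sumFin N (λ b → ⟦ stepAllowed a b false ⟧ * X b) + ⟦ t ⟧ * X a ∎
  where open ≡-Reasoning

*-sumFin-sumComps : (N n L : ℕ) (s : Fin N → ℕ) (F : Fin N → List ℕ → ℕ) →
  L * sumFin N (λ b → s b * sumComps n (F b)) ≡ sumComps n (λ c → L * sumFin N (λ b → s b * F b c))
*-sumFin-sumComps N n L s F = begin
    L * sumFin N (λ b → s b * sumComps n (F b))
      ≡⟨ cong (L *_) (sumOver-cong (allFin N) (λ b → sym (sumOver-*ˡ (compositions n) (s b) (F b)))) ⟩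
    L * sumFin N (λ b → sumComps n (λ c → s b * F b c))
      ≡⟨ cong (L *_) (sumOver-comm (allFin N) (compositions n) _) ⟩
    L * sumComps n (λ c → sumFin N (λ b → s b * F b c))
      ≡⟨ sumOver-*ˡ (compositions n) L _ ⟨
    sumComps n (λ c → L * sumFin N (λ b → s b * F b c)) ∎
  where open ≡-Reasoning

module ChainStepCount (k : ℕ) (γ w : Fin (suc (suc k)) → ℕ) (pos : ∀ u → 1 ≤ w u)
                      (inj : Injective _≡_ _≡_ γ) {N : ℕ} (a : Fin N) (e : List ℕ) where
  open ChainStep k γ w pos

  t fits : Bool
  t = γ₀ <ᵇ γ₁
  fits = single a w₀ ≤ᵛ e

  e′ : List ℕ
  e′ = e ∸ᵛ single a w₀

  G : List ℕ → ℕ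
  G = intervalTerm γ w a e

  -- A filling of the rest of the chain starting at b > a contributes to the composition
  -- w₀ ∷ c; one starting at b = a (allowed only across an ascent) to the merged composition.
  intervalTerm-step : ∀ x r → 1 ≤ x →
    ⟦ fits ⟧ * sumFin N (λ b → ⟦ stepAllowed a b t ⟧ * intervalTerm γ′ w′ b e′ (x ∷ r))
      ≡ G (w₀ ∷ x ∷ r) + sumOver (mergeFirst w₀ (x ∷ r)) G
  intervalTerm-step x r 1≤x = begin
      ⟦ fits ⟧ * sumFin N (λ b → ⟦ stepAllowed a b t ⟧ * (⟦ P′ ⟧ * mFrom c b e′))
        ≡⟨ cong (⟦ fits ⟧ *_) (sumFin-stepAllowed N a t (λ b → ⟦ P′ ⟧ * mFrom c b e′)) ⟩
      ⟦ fits ⟧ * (sumFin N (λ b → ⟦ stepAllowed a b false ⟧ * (⟦ P′ ⟧ * mFrom c b e′))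
                  + ⟦ t ⟧ * (⟦ P′ ⟧ * mFrom c a e′))
        ≡⟨ cong (λ z → ⟦ fits ⟧ * (z + ⟦ t ⟧ * (⟦ P′ ⟧ * mFrom c a e′)))
             (trans (sumOver-cong (allFin N) (λ b → *-exchangeˡ ⟦ stepAllowed a b false ⟧ ⟦ P′ ⟧ (mFrom c b e′)))
                    (sumOver-*ˡ (allFin N) ⟦ P′ ⟧ (λ b → ⟦ stepAllowed a b false ⟧ * mFrom c b e′))) ⟩
      ⟦ fits ⟧ * (⟦ P′ ⟧ * strictSum + ⟦ t ⟧ * (⟦ P′ ⟧ * mFrom c a e′))
        ≡⟨ rearrange ⟦ fits ⟧ ⟦ P′ ⟧ strictSum ⟦ t ⟧ (mFrom c a e′) ⟩
      ⟦ P′ ⟧ * (⟦ fits ⟧ * strictSum) + (⟦ t ⟧ * ⟦ P′ ⟧ * (⟦ fits ⟧ * mFrom c a e′) + 0)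
        ≡⟨ cong₂ (λ u v → ⟦ u ⟧ * (⟦ fits ⟧ * strictSum) + (v * (⟦ fits ⟧ * mFrom c a e′) + 0))
             (sym (inInterval-∷ x r 1≤x)) (sym (trans (cong ⟦_⟧ (inInterval-+head inj x r 1≤x)) (⟦∧⟧ t P′))) ⟩
      ⟦ inInterval γ w (w₀ ∷ c) ⟧ * (⟦ fits ⟧ * strictSum)
        + (⟦ inInterval γ w ((w₀ + x) ∷ r) ⟧ * (⟦ fits ⟧ * mFrom c a e′) + 0)
        ≡⟨ cong (λ z → ⟦ inInterval γ w (w₀ ∷ c) ⟧ * (⟦ fits ⟧ * strictSum)
                       + (⟦ inInterval γ w ((w₀ + x) ∷ r) ⟧ * z + 0))
                (mFrom-+ w₀ x r a e) ⟨
      G (w₀ ∷ c) + sumOver (mergeFirst w₀ c) G ∎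
    where
    open ≡-Reasoning
    open +-*-Solver using (solve; _:+_; _:*_; _:=_; con)
    c : List ℕ
    c = x ∷ r
    P′ : Bool
    P′ = inInterval γ′ w′ c
    strictSum : ℕ
    strictSum = sumFin N (λ b → ⟦ stepAllowed a b false ⟧ * mFrom c b e′)
    rearrange : ∀ L P S t X → L * (P * S + t * (P * X)) ≡ P * (L * S) + (t * P * (L * X) + 0)
    rearrange = solve 5 (λ L P S t X → L :* (P :* S :+ t :* (P :* X))
                                      := P :* (L :* S) :+ (t :* P :* (L :* X) :+ con 0)) refl

  intervalTerm-byComposition : ∀ c → Positive c → sum c ≡ weight w′ →
    ⟦ fits ⟧ * sumFin N (λ b → ⟦ stepAllowed a b t ⟧ * intervalTerm γ′ w′ b e′ c)
      ≡ G (w₀ ∷ c) + sumOver (mergeFirst w₀ c) G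
  intervalTerm-byComposition []      _         Σc = ⊥-elim (<-irrefl Σc (≤-trans (pos (fsuc fzero)) (m≤m+n _ _)))
  intervalTerm-byComposition (x ∷ r) (1≤x ∷ _) _  = intervalTerm-step x r 1≤x

fillingsFrom-interval-single : (γ w : Fin 1 → ℕ) → 1 ≤ w fzero → {N : ℕ} (a : Fin N) (e : List ℕ) →
  fillingsFrom (tabulate w) [] a e ≡ sumComps (weight w) (intervalTerm γ w a e)
fillingsFrom-interval-single γ w 1≤w₀ a e = sym (begin
    sumComps (w fzero + 0) G
      ≡⟨ sumComps-+ (w fzero) 0 G ⟩
    sumDescendants (w fzero) G [] + 0
      ≡⟨ cong (_+ 0) (sumDescendants-vanishing (w fzero) G [] 1≤w₀
                       (inInterval-vanishesBelow zero γ w (λ β → mFrom β a e))) ⟩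
    G (w fzero ∷ []) + 0 + 0
      ≡⟨ trans (+-identityʳ _) (+-identityʳ _) ⟩
    ⟦ inInterval γ w (w fzero ∷ []) ⟧ * mFrom (w fzero ∷ []) a e
      ≡⟨ cong (λ b → ⟦ b ⟧ * mFrom (w fzero ∷ []) a e)
              (inInterval-viaSets γ w (w fzero ∷ []) [] _ [] refl refl (setC-deltaC zero γ w 1≤w₀)) ⟩
    1 * mFrom (w fzero ∷ []) a e
      ≡⟨ *-identityˡ _ ⟩
    fillingsFrom (tabulate w) [] a e ∎)
  where
  open ≡-Reasoning
  G : List ℕ → ℕ
  G = intervalTerm γ w a e

fillingsFrom-interval : (k : ℕ) (γ w : Fin (suc k) → ℕ) → Injective _≡_ _≡_ γ → (∀ u → 1 ≤ w u) →
  {N : ℕ} (a : Fin N) (e : List ℕ) →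
  fillingsFrom (tabulate w) (ascents k γ) a e ≡ sumComps (weight w) (intervalTerm γ w a e)
fillingsFrom-interval zero    γ w inj pos     a e = fillingsFrom-interval-single γ w (pos fzero) a e
fillingsFrom-interval (suc k) γ w inj pos {N} a e = begin
    ⟦ fits ⟧ * sumFin N (λ b → ⟦ stepAllowed a b t ⟧ * fillingsFrom (tabulate w′) (ascents k γ′) b e′)
      ≡⟨ cong (⟦ fits ⟧ *_) (sumOver-cong (allFin N) (λ b → cong (⟦ stepAllowed a b t ⟧ *_)
           (fillingsFrom-interval k γ′ w′ (fsuc-injective ∘ inj) (pos ∘ fsuc) b e′))) ⟩
    ⟦ fits ⟧ * sumFin N (λ b → ⟦ stepAllowed a b t ⟧ * sumComps (weight w′) (intervalTerm γ′ w′ b e′))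
      ≡⟨ *-sumFin-sumComps N (weight w′) ⟦ fits ⟧ (λ b → ⟦ stepAllowed a b t ⟧) (λ b → intervalTerm γ′ w′ b e′) ⟩
    sumComps (weight w′) (λ c → ⟦ fits ⟧ * sumFin N (λ b → ⟦ stepAllowed a b t ⟧ * intervalTerm γ′ w′ b e′ c))
      ≡⟨ sumComps-cong (weight w′) _ _ intervalTerm-byComposition ⟩
    sumComps (weight w′) (λ c → G (w₀ ∷ c) + sumOver (mergeFirst w₀ c) G)
      ≡⟨ sumOver-cong (compositions (weight w′)) (λ c → sumDescendants-vanishing w₀ G c (pos fzero)
           (inInterval-vanishesBelow (suc k) γ w (λ β → mFrom β a e))) ⟨
    sumComps (weight w′) (sumDescendants w₀ G)
      ≡⟨ sumComps-+ w₀ (weight w′) G ⟨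
    sumComps (weight w) G ∎
  where
  open ≡-Reasoning
  open ChainStep k γ w pos
  open ChainStepCount k γ w pos inj a e

lemma3p5 : (ℓ : ℕ) (γ : Fin ℓ → ℕ) → Injective _≡_ _≡_ γ →
    (w : Fin ℓ → ℕ) → (∀ u → 1 ≤ w u) →
    (e : List ℕ) → K γ w e ≡ sumSeries (map M (interval γ w)) e
lemma3p5 zero γ inj w pos e =
  trans (cong (λ z → ⟦ eqList z e ⟧ + 0)
              (trans (expOf-empty {length e} w (λ ()))
                     (sym (expOf-empty {length e} (λ t → lookupL [] (toℕ t)) (λ ())))))
        (sym (+-identityʳ _))
lemma3p5 (suc k) γ inj w pos e = begin
    K γ w e
      ≡⟨ K-byFirstValue k γ w e ⟩
    sumFin N (λ a → fillingsFrom (tabulate w) (ascents k γ) a e)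
      ≡⟨ sumOver-cong (allFin N) (λ a → fillingsFrom-interval k γ w inj pos a e) ⟩
    sumFin N (λ a → sumComps W (intervalTerm γ w a e))
      ≡⟨ sumOver-comm (allFin N) (compositions W) _ ⟩
    sumComps W (λ β → sumFin N (λ a → intervalTerm γ w a e β))
      ≡⟨ sumComps-cong W _ _ byComposition ⟩
    sumComps W (λ β → ⟦ inInterval γ w β ⟧ * M β e)
      ≡⟨ sumOver-interval γ w (λ β → M β e) ⟨
    sumOver (interval γ w) (λ β → M β e)
      ≡⟨ sumOver-map (interval γ w) M (λ F → F e) ⟨
    sumSeries (map M (interval γ w)) e ∎
  where
  open ≡-Reasoning
  N W : ℕ
  N = length e
  W = weight w
  byComposition : ∀ β → Positive β → sum β ≡ W →
                  sumFin N (λ a → intervalTerm γ w a e β) ≡ ⟦ inInterval γ w β ⟧ * M β e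
  byComposition []      _ Σβ = ⊥-elim (<-irrefl Σβ (≤-trans (pos fzero) (m≤m+n _ _)))
  byComposition (c ∷ β) _ _  = trans (sumOver-*ˡ (allFin N) ⟦ inInterval γ w (c ∷ β) ⟧ _)
                                     (cong (⟦ inInterval γ w (c ∷ β) ⟧ *_) (sym (M-byFirstValue c β e)))
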